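{- Let $n\ge 2$. A position $x=(x_0,x_1,\ldots,x_n)\in\mathbb{Z}_{\ge0}^{n+1}$ of the game Exco-Nim is a $\mathcal{P}$-position if and only if $x_0=0$ and $x_1=x_2=\cdots=x_n$.
   Context: Exco-Nim with parameter $n\ge2$: positions are tuples $x=(x_0,x_1,\ldots,x_n)$ of nonnegative integers (pile sizes). A legal move $x\to x'$ is to a tuple $x'$ of nonnegative integers with $x'_j\le x_j$ for all $j=0,\ldots,n$, $\sum_j x'_j<\sum_j x_j$, and $x'_i=x_i$ for at least one index $1\le i\le n$ (i.e. one may reduce pile $0$ and at most $n-1$ of the piles $1,\ldots,n$, reducing at least one pile in total). Two players alternate moves; the player who cannot move loses. A $\mathcal{P}$-position is a position from which the player to move loses under optimal play (equivalently, the $\mathcal{P}$-positions form the unique set $P$ such that no move leads from a position in $P$ to a position in $P$, and from every position not in $P$ some move leads into $P$). -}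

module Defs where

open import Data.Nat using (ℕ; zero; suc; _+_; _≤_; _<_)
open import Data.Fin using (Fin; zero; suc)
open import Data.Vec.Functional using (Vector; foldr)
open import Data.Product using (Σ; _×_; ∃)
open import Relation.Binary.PropositionalEquality using (_≡_)

Position : ℕ → Set
Position n = Vector ℕ (suc n)

total : ∀ {n} → Position n → ℕ
total = foldr _+_ 0

-- Legal move x → x': no pile increases, total strictly decreases,
-- and some pile i with 1 ≤ i ≤ n (i.e. index suc i, i : Fin n) is unchanged.
Move : ∀ {n} → Position n → Position n → Set
Move {n} x x' =
  (∀ j → x' j ≤ x j) × (total x' < total x) × (∃ λ (i : Fin n) → x' (suc i) ≡ x (suc i))

-- Normal-play outcome classes, defined mutually inductively
-- (the game is well-founded since the total strictly decreases).
data IsP {n : ℕ} (x : Position n) : Set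
data IsN {n : ℕ} (x : Position n) : Set

data IsP {n} x where
  allMovesToN : (∀ x' → Move x x' → IsN x') → IsP x

data IsN {n} x where
  moveToP : (x' : Position n) → Move x x' → IsP x' → IsN x

module Submission where

-- Call a position balanced when pile 0 is empty and piles 1..n
-- are all equal.  The theorem is an instance of the standard characterisation
-- of P-positions: a set S of positions equals the set of P-positions as soon as
--   (closed)    no move leads from an S-position to an S-position, and
--   (reachable) every position is in S or has a move into S.
-- This is proved once for an arbitrary predicate S (by well-founded induction
-- on the total number of tokens, plus the fact that no position is both P and N).
-- For Exco-Nim the balanced positions satisfy both conditions:
--   * flattening x (empty pile 0, cut piles 1..n down to their minimum m) keeps
--     a pile of size m unchanged, so it is a legal move unless it removes
--     nothing, in which case x was already balanced;
--   * a move between balanced positions keeps some pile i ≥ 1 fixed, hence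
--     keeps all piles fixed, so it cannot decrease the total.
-- The argument only needs n ≥ 1.

open import Defs
open import Data.Nat using (ℕ; zero; suc; _+_; _≤_; _<_; _⊓_; z≤n; _<?_)
open import Data.Nat.Properties
  using (≤-refl; ≤-trans; ≤-reflexive; ≤-antisym; +-mono-≤; +-monoˡ-≤; +-monoʳ-≤;
         +-cancelˡ-≤; +-cancelʳ-≤; m⊓n≤m; m⊓n≤n; ⊓-sel; <-trans; <⇒≱; ≮⇒≥)
open import Data.Nat.Induction using (<-wellFounded)
open import Induction.WellFounded using (Acc; acc)
open import Data.Fin using (Fin; zero; suc)
open import Data.Vec.Functional using (Vector; tail; foldr)
open import Data.Product using (Σ; ∃; _×_; _,_; proj₁; proj₂)
open import Data.Sum using (_⊎_; inj₁; inj₂)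
open import Data.Empty using (⊥; ⊥-elim)
open import Relation.Nullary using (¬_; yes; no)
open import Function.Bundles using (_⇔_; mk⇔)
open import Relation.Binary.PropositionalEquality using (_≡_; refl; sym; trans)

_≤ᵛ_ : ∀ {k} → Vector ℕ k → Vector ℕ k → Set
y ≤ᵛ x = ∀ j → y j ≤ x j

sum : ∀ {k} → Vector ℕ k → ℕ
sum = foldr _+_ 0

sum-mono : ∀ {k} (x y : Vector ℕ k) → y ≤ᵛ x → sum y ≤ sum x
sum-mono {zero}  x y y≤x = ≤-refl
sum-mono {suc k} x y y≤x =
  +-mono-≤ (y≤x zero) (sum-mono (tail x) (tail y) (λ j → y≤x (suc j)))

add-rigid : ∀ {a b c d} → c ≤ a → d ≤ b → a + b ≤ c + d → a ≡ c × b ≡ d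
add-rigid {a} {b} {c} {d} c≤a d≤b ab≤cd =
  ≤-antisym (+-cancelʳ-≤ b a c (≤-trans ab≤cd (+-monoʳ-≤ c d≤b))) c≤a ,
  ≤-antisym (+-cancelˡ-≤ a b d (≤-trans ab≤cd (+-monoˡ-≤ d c≤a))) d≤b

sum-rigid : ∀ {k} (x y : Vector ℕ k) → y ≤ᵛ x → sum x ≤ sum y →
            ∀ j → x j ≡ y j
sum-rigid {suc k} x y y≤x sx≤sy = pointwise
  where
  tail≤ : tail y ≤ᵛ tail x
  tail≤ j = y≤x (suc j)

  heads-and-tails : x zero ≡ y zero × sum (tail x) ≡ sum (tail y)
  heads-and-tails = add-rigid (y≤x zero) (sum-mono (tail x) (tail y) tail≤) sx≤sy

  pointwise : ∀ j → x j ≡ y j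
  pointwise zero    = proj₁ heads-and-tails
  pointwise (suc j) =
    sum-rigid (tail x) (tail y) tail≤ (≤-reflexive (proj₂ heads-and-tails)) j

minimum : ∀ {k} → Vector ℕ (suc k) → ℕ
minimum {zero}  v = v zero
minimum {suc k} v = v zero ⊓ minimum (tail v)

minimum-≤ : ∀ {k} (v : Vector ℕ (suc k)) (i : Fin (suc k)) → minimum v ≤ v i
minimum-≤ {zero}  v zero    = ≤-refl
minimum-≤ {suc k} v zero    = m⊓n≤m _ _
minimum-≤ {suc k} v (suc i) = ≤-trans (m⊓n≤n _ _) (minimum-≤ (tail v) i)

minimum-attained : ∀ {k} (v : Vector ℕ (suc k)) → ∃ λ i → v i ≡ minimum v
minimum-attained {zero}  v = zero , refl
minimum-attained {suc k} v with ⊓-sel (v zero) (minimum (tail v))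
... | inj₁ min≡v₀ = zero , sym min≡v₀
... | inj₂ min≡rest with minimum-attained (tail v)
...   | i , vᵢ≡rest = suc i , trans vᵢ≡rest (sym min≡rest)

P-not-N : ∀ {n} {x : Position n} → IsP x → IsN x → ⊥
P-not-N (allMovesToN toN) (moveToP x' x→x' x'∈P) = P-not-N x'∈P (toN x' x→x')

module Characterisation {n : ℕ} (S : Position n → Set)
  (closed : ∀ x x' → S x → Move x x' → ¬ S x')
  (reachable : ∀ x → S x ⊎ Σ (Position n) (λ x' → Move x x' × S x'))
  where

  -- Every S-position is P, by well-founded induction on the total:
  -- each move leaves S, and from there some move returns into S.
  S⇒P : ∀ x → Acc _<_ (total x) → S x → IsP x
  S⇒P x (acc smaller) x∈S = allMovesToN toN
    where
    toN : ∀ x' → Move x x' → IsN x'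
    toN x' x→x'@(_ , tx'<tx , _) with reachable x'
    ... | inj₁ x'∈S = ⊥-elim (closed x x' x∈S x→x' x'∈S)
    ... | inj₂ (x'' , x'→x''@(_ , tx''<tx' , _) , x''∈S) =
      moveToP x'' x'→x'' (S⇒P x'' (smaller (<-trans tx''<tx' tx'<tx)) x''∈S)

  -- Every P-position is in S: otherwise it would move into S, hence be N.
  P⇒S : ∀ x → IsP x → S x
  P⇒S x x∈P with reachable x
  ... | inj₁ x∈S = x∈S
  ... | inj₂ (x' , x→x' , x'∈S) =
    ⊥-elim (P-not-N x∈P (moveToP x' x→x' (S⇒P x' (<-wellFounded _) x'∈S)))

  P⇔S : ∀ x → IsP x ⇔ S x
  P⇔S x = mk⇔ (P⇒S x) (S⇒P x (<-wellFounded _))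

Balanced : ∀ {n} → Position n → Set
Balanced {n} x = x zero ≡ 0 × (∀ (i j : Fin n) → x (suc i) ≡ x (suc j))

module ExcoNim (n' : ℕ) where
  private n = suc n'

  flatten : Position n → Position n
  flatten x zero    = 0
  flatten x (suc i) = minimum (tail x)

  flatten-≤ : ∀ x → flatten x ≤ᵛ x
  flatten-≤ x zero    = z≤n
  flatten-≤ x (suc i) = minimum-≤ (tail x) i

  -- Flattening is a legal move whenever it removes a token, since a pile
  -- of minimal size among piles 1..n stays unchanged.
  flatten-move : ∀ x → total (flatten x) < total x → Move x (flatten x)
  flatten-move x lt with minimum-attained (tail x)
  ... | i , xᵢ≡min = flatten-≤ x , lt , i , sym xᵢ≡min

  unshrinkable-balanced : ∀ x → ¬ (total (flatten x) < total x) → Balanced x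
  unshrinkable-balanced x not< =
    same zero , λ i j → trans (same (suc i)) (sym (same (suc j)))
    where
    same : ∀ j → x j ≡ flatten x j
    same = sum-rigid x (flatten x) (flatten-≤ x) (≮⇒≥ not<)

  reachable : ∀ (x : Position n) →
              Balanced x ⊎ Σ (Position n) (λ x' → Move x x' × Balanced x')
  reachable x with total (flatten x) <? total x
  ... | yes lt  = inj₂ (flatten x , flatten-move x lt , refl , λ i j → refl)
  ... | no not< = inj₁ (unshrinkable-balanced x not<)

  -- Between balanced positions, the pile i kept fixed by the move forces all
  -- piles to be fixed, so the total cannot decrease.
  closed : ∀ (x x' : Position n) → Balanced x → Move x x' → ¬ Balanced x'
  closed x x' (x₀≡0 , x-eq) (_ , tx'<tx , i , x'ᵢ≡xᵢ) (x'₀≡0 , x'-eq) =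
    <⇒≱ tx'<tx (sum-mono x' x x≤x')
    where
    x≤x' : x ≤ᵛ x'
    x≤x' zero    = ≤-reflexive (trans x₀≡0 (sym x'₀≡0))
    x≤x' (suc j) = ≤-reflexive (trans (x-eq j i) (trans (sym x'ᵢ≡xᵢ) (x'-eq i j)))

proposition2p1 : (n : ℕ) → 2 ≤ n → (x : Position n) →
    IsP x ⇔ (x zero ≡ 0 × (∀ (i j : Fin n) → x (suc i) ≡ x (suc j)))
proposition2p1 (suc n') _ = Characterisation.P⇔S Balanced closed reachable
  where open ExcoNim n'
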